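{- Let $u=s_{i_1}\cdots s_{i_l}$ and $v=s_{j_1}\cdots s_{j_m}$ be reduced words for glides in $\hat S_n$ with offsets $k_1$ and $k_2$ respectively, such that the concatenated word $vu=s_{j_1}\cdots s_{j_m}s_{i_1}\cdots s_{i_l}$ is reduced. Draw the wiring diagram of $v|u$ (cut between $v$ and $u$), number its wires $1,\dots,n$ by their positions at the cut, and assign real parameters $\alpha_1,\dots,\alpha_n$ to the wires; assume $\alpha_i\neq\alpha_j$ whenever wires $i$ and $j$ cross. Let $\mathbf z_{ -\infty}=(z_1,\dots,z_m)$ and $\mathbf w=(w_1,\dots,w_l)$ be defined by declaring that the parameter of each crossing (in $v$, resp. $u$) equals $\alpha_{\text{upper}}-\alpha_{\text{lower}}$, where upper and lower are the upper and lower wires of that crossing. Then $F_{v,u}(\mathbf z_{ -\infty},\mathbf w)=(\mathbf w,\mathbf z_{ -\infty})$. Moreover, in the resulting weighted word $\rho^{k_2}(u)\rho^{ -k_1}(v)$ (whose wires are the same wires, carried along by the braid and commutation moves), every crossing parameter again equals $\alpha_{\text{upper}}-\alpha_{\text{lower}}$ for the two wires crossing there.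
   Context: $\hat S_n$ is the affine symmetric group with generators $s_0,\dots,s_{n-1}$ (indices mod $n$), relations $s_i^2=1$, $s_is_js_i=s_js_is_j$ for $i-j\equiv\pm1$, $s_is_j=s_js_i$ for $i-j\not\equiv0,\pm1 \pmod n$; $\rho$ is the automorphism $s_i\mapsto s_{i+1}$. With $\phi:\hat S_n\to S_n$, $\phi(s_i)=(i\ i+1)$, $\phi(s_0)=(1\ n)$, a glide of offset $k\in\{0,\dots,n-1\}$ is an element $g$ with $\phi(g)$ equal to the cyclic shift $j\mapsto j+k \pmod n$. For glides $u,v$ of offsets $k_1,k_2$ one has $vu=\rho^{k_2}(u)\rho^{ -k_1}(v)$, so the reduced words $s_{j_1}\cdots s_{j_m}s_{i_1}\cdots s_{i_l}$ and $s_{i_1+k_2}\cdots s_{i_l+k_2}s_{j_1-k_1}\cdots s_{j_m-k_1}$ are connected by braid and commutation moves. The map $F_{v,u}$: attach weights $z_1,\dots,z_m,y_1,\dots,y_l$ to the letters of $vu$, and transform the weights along such a sequence of moves by Lusztig's rules $s_i(a)s_j(b)s_i(c)\mapsto s_j\!\left(\tfrac{bc}{a+c}\right)s_i(a+c)s_j\!\left(\tfrac{ab}{a+c}\right)$ for $i-j\equiv\pm1$ and $s_i(a)s_j(b)\mapsto s_j(b)s_i(a)$ for $i-j\not\equiv 0,\pm1$; the resulting weights $(y_1',\dots,y_l')$ on $\rho^{k_2}(u)$ and $(z_1',\dots,z_m')$ on $\rho^{ -k_1}(v)$ define $F_{v,u}(\mathbf z,\mathbf y)=(\mathbf y',\mathbf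 z')$, which is independent of the chosen sequence of moves. Wiring diagrams: the word is drawn on a cylinder with $n$ wires occupying positions $1,\dots,n$ (mod $n$); a letter $s_i$ is a crossing exchanging the wires in positions $i$ and $i+1$ ($s_0$ exchanges positions $n$ and $1$). The upper wire of a crossing $s_i$ is the one in position $i+1$ (position $1$ if $i=0$) just before the crossing and in position $i$ (position $n$ if $i=0$) just after; the other is the lower wire. -}

module Defs where

open import Level using (Level; _⊔_)
open import Data.Nat using (ℕ; _∸_; _≤_; NonZero) renaming (_+_ to _+ℕ_)
open import Data.Nat.DivMod using (_mod_)
open import Data.Fin using (Fin; toℕ; _≟_)
open import Data.List using (List; []; _∷_; _++_; map; length)
open import Data.Product using (_×_; _,_; proj₁; proj₂)
open import Data.Sum using (_⊎_)
open import Relation.Nullary using (¬_; yes; no)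
open import Relation.Binary.PropositionalEquality using (_≡_)
open import Relation.Binary.Construct.Closure.Equivalence using (EqClosure)
open import Relation.Binary.Construct.Closure.ReflexiveTransitive using (Star)
open import Algebra.Bundles using (CommutativeRing)

-- Fields (the reals are only used through their field structure).
-- The inverse is a total function; its value at 0 is unconstrained.

record Field (c ℓ : Level) : Set (Level.suc (c ⊔ ℓ)) where
  field
    commutativeRing : CommutativeRing c ℓ
  open CommutativeRing commutativeRing public
  field
    _⁻¹       : Carrier → Carrier
    ⁻¹-cong   : ∀ {x y} → x ≈ y → x ⁻¹ ≈ y ⁻¹
    ⁻¹-inverse : ∀ x → ¬ (x ≈ 0#) → x * (x ⁻¹) ≈ 1#
    0≉1       : ¬ (0# ≈ 1#)

module AffineSym (n : ℕ) .{{nz : NonZero n}} where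

  Letter : Set
  Letter = Fin n

  Word : Set
  Word = List Letter

  addF : ℕ → Fin n → Fin n
  addF k i = (toℕ i +ℕ k) mod n

  subF : Fin n → Fin n → Fin n
  subF k i = (toℕ i +ℕ (n ∸ toℕ k)) mod n

  succF predF : Fin n → Fin n
  succF = addF 1
  predF = addF (n ∸ 1)

  Adj : Letter → Letter → Set
  Adj i j = (j ≡ succF i) ⊎ (j ≡ predF i)

  Far : Letter → Letter → Set
  Far i j = ¬ (i ≡ j) × ¬ Adj i j

  data RelStep : Word → Word → Set where
    cancel : ∀ pre post i →
      RelStep (pre ++ i ∷ i ∷ post) (pre ++ post)
    braid  : ∀ pre post i j → Adj i j →
      RelStep (pre ++ i ∷ j ∷ i ∷ post) (pre ++ j ∷ i ∷ j ∷ post)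
    comm   : ∀ pre post i j → Far i j →
      RelStep (pre ++ i ∷ j ∷ post) (pre ++ j ∷ i ∷ post)

  _≃w_ : Word → Word → Set
  _≃w_ = EqClosure RelStep

  Reduced : Word → Set
  Reduced w = ∀ w' → w ≃w w' → length w ≤ length w'

  -- Positions 1,…,n are encoded 0-based as Fin n (position p ↔ p-1).
  -- φ(s_i) = transposition of positions i and i+1 (1-based), i.e. of
  -- 0-based positions predF i and i; φ(s_0) = (1 n).
  swap : Fin n → Fin n → Fin n → Fin n
  swap a b x with x ≟ a
  ... | yes _ = b
  ... | no _ with x ≟ b
  ...   | yes _ = a
  ...   | no _ = x

  swapAt : Letter → Fin n → Fin n
  swapAt i = swap (predF i) i

  φ : Word → Fin n → Fin n
  φ [] x = x
  φ (i ∷ w) x = swapAt i (φ w x)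

  IsGlide : Fin n → Word → Set
  IsGlide k w = ∀ x → φ w x ≡ addF (toℕ k) x

  ρ^ : Fin n → Word → Word
  ρ^ k = map (addF (toℕ k))

  ρ^- : Fin n → Word → Word
  ρ^- k = map (subF k)

  -- Wiring diagrams. A configuration assigns to each (0-based) position
  -- the label of the wire occupying it. Words are read left to right.

  Conf : Set
  Conf = Fin n → Fin n

  -- configuration at the left end of a word, given the one at its right end
  confBefore : Word → Conf → Conf
  confBefore [] c = c
  confBefore (i ∷ w) c x = confBefore w c (swapAt i x)

  -- for each crossing, (upper wire , lower wire), given the configuration
  -- at the left end.  Upper wire of s_i: the one in (1-based) position
  -- i+1 (position 1 if i = 0) just before, i.e. 0-based position i;
  -- lower wire: 0-based position i-1 (mod n).
  crossings : Conf → Word → List (Fin n × Fin n)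
  crossings c [] = []
  crossings c (i ∷ w) = (c i , c (predF i)) ∷ crossings (λ x → c (swapAt i x)) w

module Weighted {c ℓ} (𝔽 : Field c ℓ) (n : ℕ) .{{nz : NonZero n}} where
  open Field 𝔽
  open AffineSym n

  WWord : Set c
  WWord = List (Letter × Carrier)

  attach : Word → List Carrier → WWord
  attach [] _ = []
  attach (_ ∷ _) [] = []
  attach (i ∷ w) (a ∷ as) = (i , a) ∷ attach w as

  letters : WWord → Word
  letters = map (λ p → proj₁ p)

  weights : WWord → List Carrier
  weights = map (λ p → proj₂ p)

  data Move : WWord → WWord → Set c where
    braid : ∀ pre post i j a b c → Adj i j →
      Move (pre ++ (i , a) ∷ (j , b) ∷ (i , c) ∷ post)
           (pre ++ (j , (b * c) * ((a + c) ⁻¹)) ∷ (i , a + c)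
                 ∷ (j , (a * b) * ((a + c) ⁻¹)) ∷ post)
    comm  : ∀ pre post i j a b → Far i j →
      Move (pre ++ (i , a) ∷ (j , b) ∷ post)
           (pre ++ (j , b) ∷ (i , a) ∷ post)

  Moves : WWord → WWord → Set c
  Moves = Star Move

  param : (Fin n → Carrier) → Fin n × Fin n → Carrier
  param α (up , lo) = α up - α lo

-- Call a weighted word wire-weighted if each crossing carries α(upper) − α(lower), the two
-- values being distinct. A commutation move keeps the wires of both crossings. A braid move
-- acts on three wires x, y, z whose crossings carry x − y, z − y, z − x (or the reverse); the
-- middle weight is the sum of the outer ones, so Lusztig's rule merely reverses the outer
-- weights, which is exactly the wire-weighting of the new word. Hence every word reached from
-- v u is wire-weighted. For ρ^{k₂}(u) ρ^{-k₁}(v), the glide property identifies its crossings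
-- with those of u followed by those of v, so its weights are w followed by z.
module Submission where

open import Defs
open import Data.Nat using (ℕ; _≤_; NonZero)
open import Data.Fin using (Fin)
open import Data.List using (List; _++_; map)
open import Data.List.Membership.Propositional using (_∈_)
open import Data.List.Relation.Binary.Pointwise using (Pointwise)
open import Data.Product using (_×_; _,_)
open import Relation.Nullary using (¬_)
open import Relation.Binary.PropositionalEquality using (_≡_)

open import Data.Nat using (_<_; _∸_; z≤n; s≤s) renaming (_+_ to _+ℕ_)
open import Data.Nat.DivMod using (_%_; %-distribˡ-+; m%n%n≡m%n; [m+n]%n≡m%n; n%n≡0; m<n⇒m%n≡m)
open import Data.Fin using (toℕ; _≟_)
open import Data.Fin.Properties using (toℕ-fromℕ<; toℕ-injective; toℕ<n)
open import Data.Empty using (⊥-elim)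
open import Data.Sum using (inj₁; inj₂)
open import Data.Product using (proj₁; proj₂)
open import Data.Unit.Polymorphic using (⊤)
open import Data.List using ([]; _∷_)
open import Data.List.Properties using (map-++)
open import Data.List.Relation.Binary.Pointwise using ([]; _∷_)
open import Data.List.Relation.Unary.Any using (here; there)
open import Data.List.Membership.Propositional.Properties using (∈-++⁺ˡ; ∈-++⁺ʳ)
open import Function using (id; _∘_)
open import Function.Definitions using (Injective)
open import Relation.Nullary using (yes; no)
open import Relation.Binary.PropositionalEquality
  using (refl; sym; trans; cong; cong₂; subst; _≢_; _≗_; module ≡-Reasoning)
open import Relation.Binary.Construct.Closure.ReflexiveTransitive using (ε; _◅_)

[m%n+k]%n≡[m+k]%n : ∀ m k n .{{_ : NonZero n}} → (m % n +ℕ k) % n ≡ (m +ℕ k) % n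
[m%n+k]%n≡[m+k]%n m k n = begin
  (m % n +ℕ k) % n         ≡⟨ %-distribˡ-+ (m % n) k n ⟩
  (m % n % n +ℕ k % n) % n ≡⟨ cong (λ r → (r +ℕ k % n) % n) (m%n%n≡m%n m n) ⟩
  (m % n +ℕ k % n) % n     ≡⟨ %-distribˡ-+ m k n ⟨
  (m +ℕ k) % n             ∎
  where open ≡-Reasoning

module CyclicShift (n : ℕ) .{{_ : NonZero n}} where
  open AffineSym n
  open import Data.Nat.Properties using (+-assoc; +-comm; m+[n∸m]≡n; m∸n+n≡m; <⇒≤; <⇒≢)
  open ≡-Reasoning

  toℕ-addF : ∀ k x → toℕ (addF k x) ≡ (toℕ x +ℕ k) % n
  toℕ-addF k x = toℕ-fromℕ< _

  addF-addF : ∀ a b x → addF b (addF a x) ≡ addF (a +ℕ b) x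
  addF-addF a b x = toℕ-injective (begin
    toℕ (addF b (addF a x))     ≡⟨ toℕ-addF b (addF a x) ⟩
    (toℕ (addF a x) +ℕ b) % n   ≡⟨ cong (λ r → (r +ℕ b) % n) (toℕ-addF a x) ⟩
    ((toℕ x +ℕ a) % n +ℕ b) % n ≡⟨ [m%n+k]%n≡[m+k]%n (toℕ x +ℕ a) b n ⟩
    (toℕ x +ℕ a +ℕ b) % n       ≡⟨ cong (_% n) (+-assoc (toℕ x) a b) ⟩
    (toℕ x +ℕ (a +ℕ b)) % n     ≡⟨ toℕ-addF (a +ℕ b) x ⟨
    toℕ (addF (a +ℕ b) x)       ∎)

  addF-n : ∀ x → addF n x ≡ x
  addF-n x = toℕ-injective (begin
    toℕ (addF n x)      ≡⟨ toℕ-addF n x ⟩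
    (toℕ x +ℕ n) % n    ≡⟨ [m+n]%n≡m%n (toℕ x) n ⟩
    toℕ x % n           ≡⟨ m<n⇒m%n≡m (toℕ<n x) ⟩
    toℕ x               ∎)

  addF-comm : ∀ a b x → addF a (addF b x) ≡ addF b (addF a x)
  addF-comm a b x = begin
    addF a (addF b x) ≡⟨ addF-addF b a x ⟩
    addF (b +ℕ a) x   ≡⟨ cong (λ k → addF k x) (+-comm b a) ⟩
    addF (a +ℕ b) x   ≡⟨ addF-addF a b x ⟨
    addF b (addF a x) ∎

  predF-addF : ∀ k i → predF (addF k i) ≡ addF k (predF i)
  predF-addF k i = addF-comm (n ∸ 1) k i

  addF-inverseˡ : ∀ {k} → k ≤ n → ∀ x → addF (n ∸ k) (addF k x) ≡ x
  addF-inverseˡ {k} k≤n x = begin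
    addF (n ∸ k) (addF k x) ≡⟨ addF-addF k (n ∸ k) x ⟩
    addF (k +ℕ (n ∸ k)) x   ≡⟨ cong (λ m → addF m x) (m+[n∸m]≡n k≤n) ⟩
    addF n x                ≡⟨ addF-n x ⟩
    x                       ∎

  addF-inverseʳ : ∀ {k} → k ≤ n → ∀ x → addF k (addF (n ∸ k) x) ≡ x
  addF-inverseʳ {k} k≤n x = begin
    addF k (addF (n ∸ k) x) ≡⟨ addF-addF (n ∸ k) k x ⟩
    addF (n ∸ k +ℕ k) x     ≡⟨ cong (λ m → addF m x) (m∸n+n≡m k≤n) ⟩
    addF n x                ≡⟨ addF-n x ⟩
    x                       ∎

  addF-injective : ∀ {k} → k ≤ n → Injective _≡_ _≡_ (addF k)
  addF-injective {k} k≤n {x} {y} eq = begin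
    x                       ≡⟨ addF-inverseˡ k≤n x ⟨
    addF (n ∸ k) (addF k x) ≡⟨ cong (addF (n ∸ k)) eq ⟩
    addF (n ∸ k) (addF k y) ≡⟨ addF-inverseˡ k≤n y ⟩
    y                       ∎

  toℕ-addF-complement : ∀ a x → toℕ (addF (n ∸ toℕ x) (addF a x)) ≡ a % n
  toℕ-addF-complement a x = begin
    toℕ (addF (n ∸ t) (addF a x)) ≡⟨ cong toℕ (addF-addF a (n ∸ t) x) ⟩
    toℕ (addF (a +ℕ (n ∸ t)) x)   ≡⟨ toℕ-addF (a +ℕ (n ∸ t)) x ⟩
    (t +ℕ (a +ℕ (n ∸ t))) % n     ≡⟨ cong (_% n) (+-assoc t a (n ∸ t)) ⟨
    (t +ℕ a +ℕ (n ∸ t)) % n       ≡⟨ cong (λ m → (m +ℕ (n ∸ t)) % n) (+-comm t a) ⟩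
    (a +ℕ t +ℕ (n ∸ t)) % n       ≡⟨ cong (_% n) (+-assoc a t (n ∸ t)) ⟩
    (a +ℕ (t +ℕ (n ∸ t))) % n     ≡⟨ cong (λ m → (a +ℕ m) % n) (m+[n∸m]≡n (<⇒≤ (toℕ<n x))) ⟩
    (a +ℕ n) % n                  ≡⟨ [m+n]%n≡m%n a n ⟩
    a % n                         ∎
    where t = toℕ x

  addF-no-fixed-point : ∀ {a} → 0 < a → a < n → ∀ x → addF a x ≢ x
  addF-no-fixed-point {a} 0<a a<n x eq = <⇒≢ 0<a (sym (begin
    a                                   ≡⟨ m<n⇒m%n≡m a<n ⟨
    a % n                               ≡⟨ toℕ-addF-complement a x ⟨
    toℕ (addF (n ∸ toℕ x) (addF a x))   ≡⟨ cong (toℕ ∘ addF (n ∸ toℕ x)) eq ⟩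
    toℕ (addF (n ∸ toℕ x) x)            ≡⟨ toℕ-addF (n ∸ toℕ x) x ⟩
    (toℕ x +ℕ (n ∸ toℕ x)) % n          ≡⟨ cong (_% n) (m+[n∸m]≡n (<⇒≤ (toℕ<n x))) ⟩
    n % n                               ≡⟨ n%n≡0 n ⟩
    0                                   ∎))

module Transposition (n : ℕ) .{{_ : NonZero n}} where
  open AffineSym n
  open ≡-Reasoning

  swap-left : ∀ a b → swap a b a ≡ b
  swap-left a b with a ≟ a
  ... | yes _  = refl
  ... | no a≢a = ⊥-elim (a≢a refl)

  swap-right : ∀ a b → swap a b b ≡ a
  swap-right a b with b ≟ a
  ... | yes b≡a = b≡a
  ... | no _ with b ≟ b
  ...   | yes _  = refl
  ...   | no b≢b = ⊥-elim (b≢b refl)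

  swap-other : ∀ {a b x} → x ≢ a → x ≢ b → swap a b x ≡ x
  swap-other {a} {b} {x} x≢a x≢b with x ≟ a
  ... | yes x≡a = ⊥-elim (x≢a x≡a)
  ... | no _ with x ≟ b
  ...   | yes x≡b = ⊥-elim (x≢b x≡b)
  ...   | no _    = refl

  data SwapCase (a b x : Fin n) : Set where
    at-left   : x ≡ a → SwapCase a b x
    at-right  : x ≡ b → SwapCase a b x
    elsewhere : x ≢ a → x ≢ b → SwapCase a b x

  swapCase : ∀ a b x → SwapCase a b x
  swapCase a b x with x ≟ a | x ≟ b
  ... | yes x≡a | _      = at-left x≡a
  ... | no _    | yes x≡b = at-right x≡b
  ... | no x≢a  | no x≢b  = elsewhere x≢a x≢b

  swap-conjugate : ∀ {σ : Fin n → Fin n} → Injective _≡_ _≡_ σ →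
                   ∀ a b x → swap (σ a) (σ b) (σ x) ≡ σ (swap a b x)
  swap-conjugate {σ} σ-inj a b x with swapCase a b x
  ... | at-left refl  = trans (swap-left (σ x) (σ b)) (cong σ (sym (swap-left x b)))
  ... | at-right refl = trans (swap-right (σ a) (σ x)) (cong σ (sym (swap-right a x)))
  ... | elsewhere x≢a x≢b =
    trans (swap-other (x≢a ∘ σ-inj) (x≢b ∘ σ-inj)) (cong σ (sym (swap-other x≢a x≢b)))

  swap-involutive : ∀ a b x → swap a b (swap a b x) ≡ x
  swap-involutive a b x with swapCase a b x
  ... | at-left refl  = trans (cong (swap x b) (swap-left x b)) (swap-right x b)
  ... | at-right refl = trans (cong (swap a x) (swap-right a x)) (swap-left a x)
  ... | elsewhere x≢a x≢b = trans (cong (swap a b) (swap-other x≢a x≢b)) (swap-other x≢a x≢b)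

  swap-conjugate-involution : ∀ {τ : Fin n → Fin n} → (∀ x → τ (τ x) ≡ x) →
                              ∀ a b x → τ (swap a b (τ x)) ≡ swap (τ a) (τ b) x
  swap-conjugate-involution {τ} τ² a b x = begin
    τ (swap a b (τ x))         ≡⟨ swap-conjugate τ-injective a b (τ x) ⟨
    swap (τ a) (τ b) (τ (τ x)) ≡⟨ cong (swap (τ a) (τ b)) (τ² x) ⟩
    swap (τ a) (τ b) x         ∎
    where
    τ-injective : Injective _≡_ _≡_ τ
    τ-injective {x} {y} eq = trans (sym (τ² x)) (trans (cong τ eq) (τ² y))

  -- Both sides are the transposition of A and C.
  swap-braid : ∀ {A B C} → A ≢ B → B ≢ C → A ≢ C → ∀ x →
               swap A B (swap B C (swap A B x)) ≡ swap B C (swap A B (swap B C x))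
  swap-braid {A} {B} {C} A≢B B≢C A≢C x = begin
    swap A B (swap B C (swap A B x)) ≡⟨ swap-conjugate-involution (swap-involutive A B) B C x ⟩
    swap (swap A B B) (swap A B C) x ≡⟨ cong₂ (λ p q → swap p q x)
                                          (swap-right A B) (swap-other (A≢C ∘ sym) (B≢C ∘ sym)) ⟩
    swap A C x                       ≡⟨ cong₂ (λ p q → swap p q x)
                                          (swap-other A≢B A≢C) (swap-left B C) ⟨
    swap (swap B C A) (swap B C B) x ≡⟨ swap-conjugate-involution (swap-involutive B C) A B x ⟨
    swap B C (swap A B (swap B C x)) ∎

  swap-comm : ∀ {a b c d} → swap c d a ≡ a → swap c d b ≡ b → ∀ x →
              swap a b (swap c d x) ≡ swap c d (swap a b x)
  swap-comm {a} {b} {c} {d} fix-a fix-b x = begin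
    swap a b (swap c d x)                       ≡⟨ swap-involutive c d _ ⟨
    swap c d (swap c d (swap a b (swap c d x))) ≡⟨ cong (swap c d)
                                                     (swap-conjugate-involution (swap-involutive c d) a b x) ⟩
    swap c d (swap (swap c d a) (swap c d b) x) ≡⟨ cong₂ (λ p q → swap c d (swap p q x)) fix-a fix-b ⟩
    swap c d (swap a b x)                       ∎

module Wiring (n : ℕ) .{{_ : NonZero n}} where
  open AffineSym n
  open import Data.Nat.Properties using (<⇒≤; m∸n≤m)
  open CyclicShift n
  open Transposition n
  open ≡-Reasoning

  crossing : Conf → Letter → Fin n × Fin n
  crossing c i = c i , c (predF i)

  crossings-cong : ∀ {c c′} → c ≗ c′ → ∀ w → crossings c w ≡ crossings c′ w
  crossings-cong c≗c′ []      = refl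
  crossings-cong c≗c′ (i ∷ w) =
    cong₂ _∷_ (cong₂ _,_ (c≗c′ i) (c≗c′ (predF i))) (crossings-cong (c≗c′ ∘ swapAt i) w)

  crossings-++ : ∀ c w₁ w₂ → crossings c (w₁ ++ w₂) ≡ crossings c w₁ ++ crossings (c ∘ φ w₁) w₂
  crossings-++ c []       w₂ = refl
  crossings-++ c (i ∷ w₁) w₂ = cong (crossing c i ∷_) (crossings-++ (c ∘ swapAt i) w₁ w₂)

  confBefore-φ : ∀ w c → confBefore w c ∘ φ w ≗ c
  confBefore-φ []      c x = refl
  confBefore-φ (i ∷ w) c x = trans (cong (confBefore w c) (swap-involutive (predF i) i (φ w x)))
                                   (confBefore-φ w c x)

  module _ {k} (k≤n : k ≤ n) where

    swapAt-addF : ∀ i x → swapAt (addF k i) (addF k x) ≡ addF k (swapAt i x)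
    swapAt-addF i x = begin
      swap (predF (addF k i)) (addF k i) (addF k x) ≡⟨ cong (λ p → swap p (addF k i) (addF k x)) (predF-addF k i) ⟩
      swap (addF k (predF i)) (addF k i) (addF k x) ≡⟨ swap-conjugate (addF-injective k≤n) (predF i) i x ⟩
      addF k (swapAt i x)                           ∎

    φ-ρ : ∀ w x → φ (map (addF k) w) (addF k x) ≡ addF k (φ w x)
    φ-ρ []      x = refl
    φ-ρ (i ∷ w) x = trans (cong (swapAt (addF k i)) (φ-ρ w x)) (swapAt-addF i (φ w x))

    crossings-ρ : ∀ c w → crossings c (map (addF k) w) ≡ crossings (c ∘ addF k) w
    crossings-ρ c []      = refl
    crossings-ρ c (i ∷ w) = cong₂ _∷_
      (cong (λ p → c (addF k i) , c p) (predF-addF k i))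
      (trans (crossings-ρ (c ∘ swapAt (addF k i)) w) (crossings-cong (cong c ∘ swapAt-addF i) w))

  -- As v is a glide of offset k₂, the labelling at the cut satisfies c₀ (x + k₂) = x, which
  -- undoes the rotation ρ^{k₂}; likewise u, a glide of offset k₁, undoes ρ^{-k₁}.
  crossings-glide-exchange : ∀ {u v k₁ k₂} → IsGlide k₁ u → IsGlide k₂ v →
    crossings (confBefore v id) (ρ^ k₂ u ++ ρ^- k₁ v)
      ≡ crossings id u ++ crossings (confBefore v id) v
  crossings-glide-exchange {u} {v} {k₁} {k₂} u-glide v-glide = begin
    crossings c₀ (ρ^ k₂ u ++ ρ^- k₁ v)                ≡⟨ crossings-++ c₀ (ρ^ k₂ u) (ρ^- k₁ v) ⟩
    crossings c₀ (ρ^ k₂ u) ++ crossings c₁ (ρ^- k₁ v) ≡⟨ cong₂ _++_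
        (trans (crossings-ρ k₂≤n c₀ u) (crossings-cong c₀-shifted u))
        (trans (crossings-ρ (m∸n≤m n K₁) c₁ v) (crossings-cong c₁-unshifted v)) ⟩
    crossings id u ++ crossings c₀ v                  ∎
    where
    K₁ = toℕ k₁
    K₂ = toℕ k₂
    k₁≤n = <⇒≤ (toℕ<n k₁)
    k₂≤n = <⇒≤ (toℕ<n k₂)
    c₀ = confBefore v id
    c₁ = c₀ ∘ φ (ρ^ k₂ u)

    c₀-shifted : ∀ x → c₀ (addF K₂ x) ≡ x
    c₀-shifted x = trans (cong c₀ (sym (v-glide x))) (confBefore-φ v id x)

    c₁-shifted : ∀ x → c₁ (addF K₂ x) ≡ addF K₁ x
    c₁-shifted x = begin
      c₀ (φ (ρ^ k₂ u) (addF K₂ x)) ≡⟨ cong c₀ (φ-ρ k₂≤n u x) ⟩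
      c₀ (addF K₂ (φ u x))         ≡⟨ c₀-shifted (φ u x) ⟩
      φ u x                        ≡⟨ u-glide x ⟩
      addF K₁ x                    ∎

    c₁-unshifted : ∀ y → c₁ (addF (n ∸ K₁) y) ≡ c₀ y
    c₁-unshifted y = begin
      c₁ (addF (n ∸ K₁) y)                 ≡⟨ cong (c₁ ∘ addF (n ∸ K₁)) (addF-inverseʳ k₂≤n y) ⟨
      c₁ (addF (n ∸ K₁) (addF K₂ y′))      ≡⟨ cong c₁ (addF-comm (n ∸ K₁) K₂ y′) ⟩
      c₁ (addF K₂ (addF (n ∸ K₁) y′))      ≡⟨ c₁-shifted (addF (n ∸ K₁) y′) ⟩
      addF K₁ (addF (n ∸ K₁) y′)           ≡⟨ addF-inverseʳ k₁≤n y′ ⟩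
      y′                                   ≡⟨ c₀-shifted y′ ⟨
      c₀ (addF K₂ y′)                      ≡⟨ cong c₀ (addF-inverseʳ k₂≤n y) ⟩
      c₀ y                                 ∎
      where y′ = addF (n ∸ K₂) y

module Adjacency (n : ℕ) .{{_ : NonZero n}} (3≤n : 3 ≤ n) where
  open AffineSym n
  open import Data.Nat.Properties using (≤-trans)
  open CyclicShift n
  open Transposition n
  open Wiring n
  open ≡-Reasoning

  predF-succF : ∀ i → predF (succF i) ≡ i
  predF-succF = addF-inverseˡ (≤-trans (s≤s z≤n) 3≤n)

  succF-predF : ∀ i → succF (predF i) ≡ i
  succF-predF = addF-inverseʳ (≤-trans (s≤s z≤n) 3≤n)

  succF≢id : ∀ i → succF i ≢ i
  succF≢id = addF-no-fixed-point (s≤s z≤n) (≤-trans (s≤s (s≤s z≤n)) 3≤n)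

  predF≢id : ∀ i → predF i ≢ i
  predF≢id i eq = succF≢id i (trans (cong succF (sym eq)) (succF-predF i))

  succF≢predF : ∀ i → succF i ≢ predF i
  succF≢predF i eq = addF-no-fixed-point (s≤s z≤n) 3≤n i (begin
    addF 2 i         ≡⟨ addF-addF 1 1 i ⟨
    succF (succF i)  ≡⟨ cong succF eq ⟩
    succF (predF i)  ≡⟨ succF-predF i ⟩
    i                ∎)

  Adj-sym : ∀ {i j} → Adj i j → Adj j i
  Adj-sym {i} (inj₁ refl) = inj₂ (sym (predF-succF i))
  Adj-sym {i} (inj₂ refl) = inj₁ (sym (succF-predF i))

  Far-sym : ∀ {i j} → Far i j → Far j i
  Far-sym (i≢j , ¬adj) = i≢j ∘ sym , ¬adj ∘ Adj-sym

  swapAt-Far : ∀ {i j} → Far i j → swapAt i j ≡ j × swapAt i (predF j) ≡ predF j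
  swapAt-Far {i} {j} (i≢j , ¬adj) =
    swap-other (¬adj ∘ inj₂) (i≢j ∘ sym) , swap-other Pj≢Pi Pj≢i
    where
    Pj≢Pi : predF j ≢ predF i
    Pj≢Pi eq = i≢j (trans (sym (succF-predF i)) (trans (cong succF (sym eq)) (succF-predF j)))
    Pj≢i : predF j ≢ i
    Pj≢i eq = ¬adj (inj₁ (trans (sym (succF-predF j)) (cong succF eq)))

  swapAt-comm : ∀ {i j} → Far i j → ∀ x → swapAt i (swapAt j x) ≡ swapAt j (swapAt i x)
  swapAt-comm far = swap-comm (proj₂ (swapAt-Far (Far-sym far))) (proj₁ (swapAt-Far (Far-sym far)))

  module _ (b : Letter) where
    private
      S = succF b
      P = predF b

    swapAt-succF : ∀ x → swapAt S x ≡ swap b S x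
    swapAt-succF x = cong (λ p → swap p S x) (predF-succF b)

    swapAt-braid : ∀ x → swapAt b (swapAt S (swapAt b x)) ≡ swapAt S (swapAt b (swapAt S x))
    swapAt-braid x = begin
      swapAt b (swapAt S (swapAt b x)) ≡⟨ cong (swapAt b) (swapAt-succF (swapAt b x)) ⟩
      swap P b (swap b S (swap P b x)) ≡⟨ swap-braid (predF≢id b) (succF≢id b ∘ sym) (succF≢predF b ∘ sym) x ⟩
      swap b S (swap P b (swap b S x)) ≡⟨ cong (λ y → swap b S (swap P b y)) (swapAt-succF x) ⟨
      swap b S (swapAt b (swapAt S x)) ≡⟨ swapAt-succF (swapAt b (swapAt S x)) ⟨
      swapAt S (swapAt b (swapAt S x)) ∎

    -- The words b (b+1) b and (b+1) b (b+1) cross the wires starting in positions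
    -- (b , b-1), (b+1 , b-1), (b+1 , b), in opposite orders.
    braid-crossings :
        crossing (swapAt b) S ≡ (S , P)
      × crossing (swapAt b ∘ swapAt S) b ≡ (S , b)
      × crossing id S ≡ (S , b)
      × crossing (swapAt S) b ≡ (S , P)
      × crossing (swapAt S ∘ swapAt b) S ≡ (b , P)
    braid-crossings =
      cong₂ _,_ sb-S sb-predS ,
      cong₂ _,_ (trans (cong (swapAt b) sS-b) sb-S) (trans (cong (swapAt b) sS-P) (swap-left P b)) ,
      cong (S ,_) (predF-succF b) ,
      cong₂ _,_ sS-b sS-P ,
      cong₂ _,_ (trans (cong (swapAt S) sb-S) sS-S) (trans (cong (swapAt S) sb-predS) sS-P)
      where
      sb-S : swapAt b S ≡ S
      sb-S = swap-other (succF≢predF b) (succF≢id b)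
      sb-predS : swapAt b (predF S) ≡ P
      sb-predS = trans (cong (swapAt b) (predF-succF b)) (swap-right P b)
      sS-b : swapAt S b ≡ S
      sS-b = trans (swapAt-succF b) (swap-left b S)
      sS-P : swapAt S P ≡ P
      sS-P = trans (swapAt-succF P) (swap-other (predF≢id b) (succF≢predF b ∘ sym))
      sS-S : swapAt S S ≡ b
      sS-S = trans (swapAt-succF S) (swap-right b S)

module WireWeights {f ℓ} (𝔽 : Field f ℓ) (n : ℕ) .{{_ : NonZero n}} (3≤n : 3 ≤ n)
                   (α : Fin n → Field.Carrier 𝔽) where
  open Field 𝔽 renaming (refl to ≈-refl; sym to ≈-sym; trans to ≈-trans)
  open AffineSym n
  open Weighted 𝔽 n
  open Wiring n
  open Adjacency n 3≤n
  open import Algebra.Properties.Group +-group using (x∙y⁻¹≈ε⇒x≈y)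
  open import Data.Product using () renaming (map to ×-map)
  open import Relation.Binary.Reasoning.Setoid setoid

  [x-y]+[z-x]≈z-y : ∀ x y z → (x - y) + (z - x) ≈ z - y
  [x-y]+[z-x]≈z-y x y z = begin
    (x - y) + (z - x)   ≈⟨ +-comm (x - y) (z - x) ⟩
    (z - x) + (x - y)   ≈⟨ +-assoc z (- x) (x - y) ⟩
    z + (- x + (x - y)) ≈⟨ +-congˡ (+-assoc (- x) x (- y)) ⟨
    z + ((- x + x) - y) ≈⟨ +-congˡ (+-congʳ (-‿inverseˡ x)) ⟩
    z + (0# - y)        ≈⟨ +-congˡ (+-identityˡ (- y)) ⟩
    z - y               ∎

  x*y*y⁻¹≈x : ∀ x {y} → ¬ (y ≈ 0#) → (x * y) * (y ⁻¹) ≈ x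
  x*y*y⁻¹≈x x {y} y≉0 = begin
    (x * y) * (y ⁻¹) ≈⟨ *-assoc x y (y ⁻¹) ⟩
    x * (y * (y ⁻¹)) ≈⟨ *-congˡ (⁻¹-inverse y y≉0) ⟩
    x * 1#           ≈⟨ *-identityʳ x ⟩
    x                ∎

  -- On weights (A , A + D , D) Lusztig's braid move just reverses the order (the inverse is
  -- junk at 0, whence A + D ≉ 0).
  braid-move-reverses : ∀ {a b d A B D} → a ≈ A → b ≈ B → d ≈ D → A + D ≈ B → ¬ (B ≈ 0#) →
    (b * d) * ((a + d) ⁻¹) ≈ D × a + d ≈ B × (a * b) * ((a + d) ⁻¹) ≈ A
  braid-move-reverses {a} {b} {d} {A} {B} {D} a≈A b≈B d≈D A+D≈B B≉0 = bd/B≈D , a+d≈B , ab/B≈A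
    where
    a+d≈B : a + d ≈ B
    a+d≈B = ≈-trans (+-cong a≈A d≈D) A+D≈B
    bd/B≈D = begin
      (b * d) * ((a + d) ⁻¹) ≈⟨ *-cong (*-cong b≈B d≈D) (⁻¹-cong a+d≈B) ⟩
      (B * D) * (B ⁻¹)       ≈⟨ *-congʳ (*-comm B D) ⟩
      (D * B) * (B ⁻¹)       ≈⟨ x*y*y⁻¹≈x D B≉0 ⟩
      D                      ∎
    ab/B≈A = begin
      (a * b) * ((a + d) ⁻¹) ≈⟨ *-cong (*-cong a≈A b≈B) (⁻¹-cong a+d≈B) ⟩
      (A * B) * (B ⁻¹)       ≈⟨ x*y*y⁻¹≈x A B≉0 ⟩
      A                      ∎

  Fits : Carrier → Fin n × Fin n → Set ℓ
  Fits a (x , y) = a ≈ α x - α y × ¬ (α x ≈ α y)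

  braid-fits : ∀ {a b d x y z} → Fits a (x , y) → Fits b (z , y) → Fits d (z , x) →
    Fits ((b * d) * ((a + d) ⁻¹)) (z , x) × Fits (a + d) (z , y) × Fits ((a * b) * ((a + d) ⁻¹)) (x , y)
  braid-fits {x = x} {y} {z} (a≈ , x≉y) (b≈ , z≉y) (d≈ , z≉x)
    with e₁ , e₂ , e₃ ← braid-move-reverses a≈ b≈ d≈ ([x-y]+[z-x]≈z-y (α x) (α y) (α z))
                                         (z≉y ∘ x∙y⁻¹≈ε⇒x≈y (α z) (α y))
    = (e₁ , z≉x) , (e₂ , z≉y) , (e₃ , x≉y)

  braid-fits⁻¹ : ∀ {a b d x y z} → Fits a (z , x) → Fits b (z , y) → Fits d (x , y) →
    Fits ((b * d) * ((a + d) ⁻¹)) (x , y) × Fits (a + d) (z , y) × Fits ((a * b) * ((a + d) ⁻¹)) (z , x)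
  braid-fits⁻¹ {x = x} {y} {z} (a≈ , z≉x) (b≈ , z≉y) (d≈ , x≉y)
    with e₁ , e₂ , e₃ ← braid-move-reverses a≈ b≈ d≈
                          (≈-trans (+-comm _ _) ([x-y]+[z-x]≈z-y (α x) (α y) (α z)))
                          (z≉y ∘ x∙y⁻¹≈ε⇒x≈y (α z) (α y))
    = (e₁ , x≉y) , (e₂ , z≉y) , (e₃ , z≉x)

  Fits-relabel : ∀ c π i {p a} → crossing π i ≡ p → Fits a (crossing (c ∘ π) i) → Fits a (×-map c c p)
  Fits-relabel c π i eq = subst (Fits _ ∘ ×-map c c) eq

  Fits-unrelabel : ∀ c π i {p a} → crossing π i ≡ p → Fits a (×-map c c p) → Fits a (crossing (c ∘ π) i)
  Fits-unrelabel c π i eq = subst (Fits _ ∘ ×-map c c) (sym eq)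

  WireWeighted : Conf → WWord → Set ℓ
  WireWeighted c []             = ⊤
  WireWeighted c ((i , a) ∷ ww) = Fits a (crossing c i) × WireWeighted (c ∘ swapAt i) ww

  WireWeighted-cong : ∀ {c c′} → c ≗ c′ → ∀ ww → WireWeighted c ww → WireWeighted c′ ww
  WireWeighted-cong c≗c′ []             _         = _
  WireWeighted-cong c≗c′ ((i , a) ∷ ww) (fit , ws) =
    subst (Fits a) (cong₂ _,_ (c≗c′ i) (c≗c′ (predF i))) fit ,
    WireWeighted-cong (c≗c′ ∘ swapAt i) ww ws

  WireWeighted-++ : ∀ c A B → WireWeighted c A → WireWeighted (c ∘ φ (letters A)) B →
                    WireWeighted c (A ++ B)
  WireWeighted-++ c []             B _          wB = wB
  WireWeighted-++ c ((i , a) ∷ A) B (fit , wA) wB = fit , WireWeighted-++ (c ∘ swapAt i) A B wA wB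

  WireWeighted-inside : ∀ {X Y} → (∀ c → WireWeighted c X → WireWeighted c Y) →
                        ∀ pre c → WireWeighted c (pre ++ X) → WireWeighted c (pre ++ Y)
  WireWeighted-inside X⇒Y []              c w          = X⇒Y c w
  WireWeighted-inside X⇒Y ((i , a) ∷ pre) c (fit , w) = fit , WireWeighted-inside X⇒Y pre (c ∘ swapAt i) w

  module _ (b : Letter) (c : Conf) where
    private
      S = succF b

    braid-up : ∀ a₁ a₂ a₃ post → WireWeighted c ((b , a₁) ∷ (S , a₂) ∷ (b , a₃) ∷ post) →
      WireWeighted c ((S , (a₂ * a₃) * ((a₁ + a₃) ⁻¹)) ∷ (b , a₁ + a₃)
                       ∷ (S , (a₁ * a₂) * ((a₁ + a₃) ⁻¹)) ∷ post)
    braid-up a₁ a₂ a₃ post (f₁ , f₂ , f₃ , rest)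
      with e₁ , e₂ , e₃ , e₄ , e₅ ← braid-crossings b
      with g₁ , g₂ , g₃ ← braid-fits f₁ (Fits-relabel c (swapAt b) S e₁ f₂)
                                        (Fits-relabel c (swapAt b ∘ swapAt S) b e₂ f₃)
      = Fits-unrelabel c id S e₃ g₁ , Fits-unrelabel c (swapAt S) b e₄ g₂ ,
        Fits-unrelabel c (swapAt S ∘ swapAt b) S e₅ g₃ ,
        WireWeighted-cong (cong c ∘ swapAt-braid b) post rest

    braid-down : ∀ a₁ a₂ a₃ post → WireWeighted c ((S , a₁) ∷ (b , a₂) ∷ (S , a₃) ∷ post) →
      WireWeighted c ((b , (a₂ * a₃) * ((a₁ + a₃) ⁻¹)) ∷ (S , a₁ + a₃)
                       ∷ (b , (a₁ * a₂) * ((a₁ + a₃) ⁻¹)) ∷ post)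
    braid-down a₁ a₂ a₃ post (f₁ , f₂ , f₃ , rest)
      with e₁ , e₂ , e₃ , e₄ , e₅ ← braid-crossings b
      with g₁ , g₂ , g₃ ← braid-fits⁻¹ (Fits-relabel c id S e₃ f₁) (Fits-relabel c (swapAt S) b e₄ f₂)
                                          (Fits-relabel c (swapAt S ∘ swapAt b) S e₅ f₃)
      = g₁ , Fits-unrelabel c (swapAt b) S e₁ g₂ , Fits-unrelabel c (swapAt b ∘ swapAt S) b e₂ g₃ ,
        WireWeighted-cong (sym ∘ cong c ∘ swapAt-braid b) post rest

  WireWeighted-braid : ∀ {i j} a₁ a₂ a₃ post → Adj i j → ∀ c →
    WireWeighted c ((i , a₁) ∷ (j , a₂) ∷ (i , a₃) ∷ post) →
    WireWeighted c ((j , (a₂ * a₃) * ((a₁ + a₃) ⁻¹)) ∷ (i , a₁ + a₃)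
                     ∷ (j , (a₁ * a₂) * ((a₁ + a₃) ⁻¹)) ∷ post)
  WireWeighted-braid {i} a₁ a₂ a₃ post (inj₁ refl) c = braid-up i c a₁ a₂ a₃ post
  WireWeighted-braid {i} a₁ a₂ a₃ post (inj₂ refl) c =
    subst (λ t → WireWeighted c ((t , a₁) ∷ (predF i , a₂) ∷ (t , a₃) ∷ post) →
                 WireWeighted c ((predF i , (a₂ * a₃) * ((a₁ + a₃) ⁻¹)) ∷ (t , a₁ + a₃)
                                  ∷ (predF i , (a₁ * a₂) * ((a₁ + a₃) ⁻¹)) ∷ post))
          (succF-predF i) (braid-down (predF i) c a₁ a₂ a₃ post)

  WireWeighted-comm : ∀ {i j} a₁ a₂ post → Far i j → ∀ c →
    WireWeighted c ((i , a₁) ∷ (j , a₂) ∷ post) → WireWeighted c ((j , a₂) ∷ (i , a₁) ∷ post)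
  WireWeighted-comm {i} {j} a₁ a₂ post far c (f₁ , f₂ , rest) =
    Fits-relabel c (swapAt i) j (crossing-Far far) f₂ ,
    Fits-unrelabel c (swapAt j) i (crossing-Far (Far-sym far)) f₁ ,
    WireWeighted-cong (cong c ∘ swapAt-comm far) post rest
    where
    crossing-Far : ∀ {i j} → Far i j → crossing (swapAt i) j ≡ (j , predF j)
    crossing-Far far = cong₂ _,_ (proj₁ (swapAt-Far far)) (proj₂ (swapAt-Far far))

  WireWeighted-Moves : ∀ {ww ww′} → Moves ww ww′ → ∀ c → WireWeighted c ww → WireWeighted c ww′
  WireWeighted-Moves ε c w = w
  WireWeighted-Moves (braid pre post i j a b d adj ◅ moves) c w =
    WireWeighted-Moves moves c (WireWeighted-inside (WireWeighted-braid a b d post adj) pre c w)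
  WireWeighted-Moves (comm pre post i j a b far ◅ moves) c w =
    WireWeighted-Moves moves c (WireWeighted-inside (WireWeighted-comm a b post far) pre c w)

  WireWeighted-attach : ∀ c w → (∀ a b → (a , b) ∈ crossings c w → ¬ (α a ≈ α b)) →
                        WireWeighted c (attach w (map (param α) (crossings c w)))
  WireWeighted-attach c []      _        = _
  WireWeighted-attach c (i ∷ w) distinct =
    (≈-refl , distinct _ _ (here refl)) , WireWeighted-attach (c ∘ swapAt i) w (λ a b → distinct a b ∘ there)

  letters-attach : ∀ (g : Fin n × Fin n → Carrier) c w → letters (attach w (map g (crossings c w))) ≡ w
  letters-attach g c []      = refl
  letters-attach g c (i ∷ w) = cong (i ∷_) (letters-attach g (c ∘ swapAt i) w)

  WireWeighted⇒weights : ∀ c ww → WireWeighted c ww →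
                         Pointwise _≈_ (weights ww) (map (param α) (crossings c (letters ww)))
  WireWeighted⇒weights c []             _          = []
  WireWeighted⇒weights c ((i , a) ∷ ww) (fit , w) = proj₁ fit ∷ WireWeighted⇒weights (c ∘ swapAt i) ww w

lemma4p2 : ∀ {c ℓ} (𝔽 : Field c ℓ) (n : ℕ) .{{nz : NonZero n}} → 3 ≤ n →
  let open Field 𝔽
      open AffineSym n
      open Weighted 𝔽 n
  in (u v : Word) (k₁ k₂ : Fin n) →
     Reduced u → Reduced v → IsGlide k₁ u → IsGlide k₂ v →
     Reduced (v ++ u) →
     (α : Fin n → Carrier) →
     -- wires numbered by their positions at the cut v|u
     let c₀ = confBefore v (λ x → x)
         crossV = crossings c₀ v
         crossU = crossings (λ x → x) u
         z = map (param α) crossV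
         w = map (param α) crossU
     in (∀ a b → (a , b) ∈ crossV ++ crossU → ¬ (α a ≈ α b)) →
        ∀ ww → Moves (attach v z ++ attach u w) ww →
        letters ww ≡ ρ^ k₂ u ++ ρ^- k₁ v →
        Pointwise _≈_ (weights ww) (w ++ z)
        × Pointwise _≈_ (weights ww)
            (map (param α) (crossings c₀ (ρ^ k₂ u ++ ρ^- k₁ v)))
lemma4p2 𝔽 n 3≤n u v k₁ k₂ _ _ u-glide v-glide _ α distinct ww moves letters-ww =
  subst (Pointwise _≈_ (weights ww)) exchanged final-weights , final-weights
  where
  open Field 𝔽 using (_≈_)
  open AffineSym n
  open Weighted 𝔽 n
  open Wiring n
  open WireWeights 𝔽 n 3≤n α
  c₀ = confBefore v id

  initial : WireWeighted c₀ (attach v (map (param α) (crossings c₀ v))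
                             ++ attach u (map (param α) (crossings id u)))
  initial = WireWeighted-++ c₀ _ _
    (WireWeighted-attach c₀ v (λ a b → distinct a b ∘ ∈-++⁺ˡ))
    (subst (λ l → WireWeighted (c₀ ∘ φ l) _) (sym (letters-attach (param α) c₀ v))
      (WireWeighted-cong (sym ∘ confBefore-φ v id) u′
        (WireWeighted-attach id u (λ a b → distinct a b ∘ ∈-++⁺ʳ (crossings c₀ v)))))
    where u′ = attach u (map (param α) (crossings id u))

  final-weights : Pointwise _≈_ (weights ww) (map (param α) (crossings c₀ (ρ^ k₂ u ++ ρ^- k₁ v)))
  final-weights = subst (λ l → Pointwise _≈_ (weights ww) (map (param α) (crossings c₀ l))) letters-ww
    (WireWeighted⇒weights c₀ ww (WireWeighted-Moves moves c₀ initial))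

  exchanged : map (param α) (crossings c₀ (ρ^ k₂ u ++ ρ^- k₁ v))
              ≡ map (param α) (crossings id u) ++ map (param α) (crossings c₀ v)
  exchanged = trans (cong (map (param α)) (crossings-glide-exchange {u} {v} u-glide v-glide))
                    (map-++ (param α) (crossings id u) (crossings c₀ v))
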